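{- Let $n\ge 2$, let $G$ be a finite abelian group of order $2n^2+2n+1$ with identity $e$, and let $T\subseteq G$ with $|T|=2n+1$ satisfy: (a) $e\in T$; (b) $T=T^{(-1)}$; (c) $T^2=2G-T^{(2)}+2n e$ in $\mathbb{Z}[G]$. Write $T^{(2)}T=\sum_{i=0}^N iX_i$ in $\mathbb{Z}[G]$, where $X_i$ is the set of elements of $G$ whose coefficient in $T^{(2)}T$ equals $i$ (so $\{X_0,\dots,X_N\}$ is a partition of $G$ and $N$ is the maximal coefficient). Then $$\sum_{i=1}^N|X_i|=4n+1+\sum_{s=3}^N\frac{(s-1)(s-2)}{2}|X_s|.$$
   Context: $\mathbb{Z}[G]$ is the integral group ring of $G$; a subset $A\subseteq G$ is identified with $\sum_{g\in A}g\in\mathbb{Z}[G]$, and $G$ also denotes $\sum_{g\in G}g$. For $A=\sum a_g g$ and $t\in\mathbb{Z}$, $A^{(t)}=\sum a_g g^t$. Multiplication in $\mathbb{Z}[G]$ is the convolution product. -}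

module Defs where

open import Data.Nat as ℕ using (ℕ; zero; suc; _⊔_)
open import Data.Integer as ℤ using (ℤ; +_; -[1+_]; ∣_∣)
open import Data.Fin using (Fin; zero; suc)
open import Data.Fin.Subset using (Subset)
open import Data.Vec using (lookup)
open import Data.Bool using (if_then_else_)
open import Relation.Nullary using (Dec; yes; no; does)
open import Relation.Binary.PropositionalEquality using (_≡_)
open import Algebra.Structures using (IsAbelianGroup)
open import Data.Fin using (_≟_)

-- A finite abelian group of order m, presented (up to isomorphism) on the
-- carrier Fin m with propositional equality.
record FinAbGroup (m : ℕ) : Set where
  field
    _∙_ : Fin m → Fin m → Fin m
    e : Fin m
    _⁻¹ : Fin m → Fin m
    isAbelianGroup : IsAbelianGroup _≡_ _∙_ e _⁻¹

ΣF : ∀ {n} → (Fin n → ℤ) → ℤ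
ΣF {zero} f = + 0
ΣF {suc n} f = f zero ℤ.+ ΣF (λ i → f (suc i))

countF : ∀ {n} {P : Fin n → Set} → ((x : Fin n) → Dec (P x)) → ℕ
countF {zero} d = 0
countF {suc n} d with d zero
... | yes _ = suc (countF (λ i → d (suc i)))
... | no _ = countF (λ i → d (suc i))

maxF : ∀ {n} → (Fin n → ℕ) → ℕ
maxF {zero} f = 0
maxF {suc n} f = f zero ⊔ maxF (λ i → f (suc i))

-- Σ_{i=a}^{b} f i  (natural numbers; empty if b < a)
sumFromTo : ℕ → ℕ → (ℕ → ℕ) → ℕ
sumFromTo a zero f with a
... | zero = f 0
... | suc _ = 0
sumFromTo a (suc b) f with a ℕ.≤? suc b
... | yes _ = sumFromTo a b f ℕ.+ f (suc b)
... | no _ = 0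

-- Elements of the integral group ring Z[G], as coefficient functions.
ZG : ℕ → Set
ZG m = Fin m → ℤ

module GroupRing {m : ℕ} (G : FinAbGroup m) where
  open FinAbGroup G

  -- subset A ⊆ G identified with Σ_{g∈A} g
  ⟦_⟧ : Subset m → ZG m
  ⟦ A ⟧ g = if lookup A g then + 1 else + 0

  𝔾 : ZG m
  𝔾 g = + 1

  δe : ZG m
  δe g with g ≟ e
  ... | yes _ = + 1
  ... | no _ = + 0

  _⋆_ : ZG m → ZG m → ZG m
  (A ⋆ B) g = ΣF (λ h → A h ℤ.* B ((h ⁻¹) ∙ g))

  powℕ : Fin m → ℕ → Fin m
  powℕ h zero = e
  powℕ h (suc k) = h ∙ powℕ h k

  pow : Fin m → ℤ → Fin m
  pow h (+ k) = powℕ h k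
  pow h -[1+ k ] = (powℕ h (suc k)) ⁻¹

  -- A^(t) = Σ a_h h^t ; coefficient of g is Σ_{h : h^t = g} a_h
  _⁽_⁾ : ZG m → ℤ → ZG m
  (A ⁽ t ⁾) g = ΣF (λ h → if does (pow h t ≟ g) then A h else + 0)

module Submission where

-- Write c_g ≥ 0 for the coefficients of C = T^(2) T.  Termwise 2·[c ≥ 1] + c² = 3c + 2·binom(c − 1, 2),
-- so the theorem only depends on the moments Σ c_g = (2n+1)² and Σ c_g² = 12n² + 4n + 1.
-- The first is |T|², by the augmentation map.  For the second: |G| is odd, so squaring is a bijection
-- of G, and together with T = T^(−1) this gives Σ c_g² = Σ_{x,y ∈ T} (T²)(y⁻² x²), which the hypothesis
-- T² = 2G − T^(2) + 2n e evaluates once one knows T ∩ T^(2) = {e}.  That holds because for x ≠ e with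
-- x, x² ∈ T the products e·x, x·e and x²·x⁻¹ make the coefficient of x in T² at least 3, while the
-- hypothesis bounds it by 2.

open import Defs
open import Data.Nat as ℕ using (ℕ; _≥_; _*_; _+_; _∸_; _/_)
open import Data.Integer as ℤ using (ℤ; +_; -[1+_])
open import Data.Fin using (Fin)
open import Data.Fin.Subset using (Subset; _∈_; ∣_∣)
open import Relation.Binary.PropositionalEquality using (_≡_)

open import Algebra.Bundles using (AbelianGroup; Semiring)
import Algebra.Properties.AbelianGroup as AbelianGroupProperties
import Algebra.Properties.CommutativeSemigroup as CommutativeSemigroupProperties
import Algebra.Properties.Group as GroupProperties
import Algebra.Properties.Semiring.Sum as SemiringSum
open import Data.Bool using (true; false; if_then_else_)
open import Data.Empty using (⊥)
open import Data.Fin using (zero; suc; _≟_; _<?_)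
import Data.Fin.Properties as FinP
open import Data.Fin.Permutation using (permutation)
import Data.Integer.Tactic.RingSolver as ℤ-Solver
open import Data.Nat using (zero; suc; _≤_; _≤?_; z≤n; s≤s; s≤s⁻¹)
open import Data.Nat.Divisibility using (_∣_; divides; ∣1⇒≡1; ∣m+n∣m⇒∣n; ∣m∣n⇒∣m+n; m∣m*n)
open import Data.Nat.DivMod using (m*[n/m]≡n)
import Data.Nat.Properties as ℕP
open import Data.Nat.Tactic.RingSolver using (solve-∀)
import Data.Integer.Properties as ℤP
open import Data.Sum using (_⊎_; inj₁; inj₂)
open import Data.Vec using ([]; _∷_; lookup)
open import Data.Vec.Properties using ([]=⇒lookup)
open import Function using (_∘_)
open import Level using (0ℓ)
open import Relation.Binary using (tri<; tri≈; tri>)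
open import Relation.Binary.PropositionalEquality
  using (refl; sym; trans; cong; cong₂; subst; subst₂; _≢_; module ≡-Reasoning)
open import Relation.Nullary using (Dec; yes; no; does; ¬_; contradiction)
open import Relation.Nullary.Decidable using (dec-true; dec-false)

module Summation {c ℓ} (R : Semiring c ℓ) where
  private module R = Semiring R
  open R using (Carrier; _≈_)
  open SemiringSum R public

  sum-linear : ∀ {k} a b (f g : Fin k → Carrier) →
               ∑[ x < k ] (a R.* f x R.+ b R.* g x) ≈ a R.* sum f R.+ b R.* sum g
  sum-linear a b f g = R.trans (∑-distrib-+ (λ x → a R.* f x) (λ x → b R.* g x))
                               (R.+-cong (R.sym (*-distribˡ-sum a f)) (R.sym (*-distribˡ-sum b g)))

  sum-*-sum : ∀ {k l} (f : Fin k → Carrier) (g : Fin l → Carrier) →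
              sum f R.* sum g ≈ ∑[ x < k ] ∑[ y < l ] (f x R.* g y)
  sum-*-sum f g = R.trans (*-distribʳ-sum (sum g) f) (sum-cong-≋ (λ x → *-distribˡ-sum (f x) g))

  ∑∑-distrib-+ : ∀ {k l} (f g : Fin k → Fin l → Carrier) →
                 ∑[ x < k ] ∑[ y < l ] (f x y R.+ g x y) ≈ ∑[ x < k ] ∑[ y < l ] f x y R.+ ∑[ x < k ] ∑[ y < l ] g x y
  ∑∑-distrib-+ f g = R.trans (sum-cong-≋ (λ x → ∑-distrib-+ (f x) (g x)))
                             (∑-distrib-+ (λ x → sum (f x)) (λ x → sum (g x)))

  ∑∑-linear : ∀ {k l} a b (f g : Fin k → Fin l → Carrier) →
              ∑[ x < k ] ∑[ y < l ] (a R.* f x y R.+ b R.* g x y)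
              ≈ a R.* ∑[ x < k ] ∑[ y < l ] f x y R.+ b R.* ∑[ x < k ] ∑[ y < l ] g x y
  ∑∑-linear a b f g = R.trans (sum-cong-≋ (λ x → sum-linear a b (f x) (g x)))
                              (sum-linear a b (λ x → sum (f x)) (λ x → sum (g x)))

module ℤΣ = Summation ℤP.+-*-semiring
module ℕΣ = Summation ℕP.+-*-semiring
open ℤΣ using (sum; sum-syntax; sum-cong-≗; ∑-distrib-+; ∑-comm; *-distribˡ-sum; *-distribʳ-sum)

if-yes : ∀ {a p} {A : Set a} {P : Set p} (d : Dec P) {x y : A} → P → (if does d then x else y) ≡ x
if-yes d p rewrite dec-true d p = refl

if-no : ∀ {a p} {A : Set a} {P : Set p} (d : Dec P) {x y : A} → ¬ P → (if does d then x else y) ≡ y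
if-no d ¬p rewrite dec-false d ¬p = refl

ΣF≡sum : ∀ {k} (f : Fin k → ℤ) → ΣF f ≡ sum f
ΣF≡sum {zero}  f = refl
ΣF≡sum {suc k} f = cong (ℤ._+_ (f zero)) (ΣF≡sum (f ∘ suc))

sum-zero : ∀ {k} {f : Fin k → ℤ} → (∀ x → f x ≡ + 0) → sum f ≡ + 0
sum-zero {k} f≗0 = trans (sum-cong-≗ f≗0) (ℤΣ.sum-replicate-zero k)

sum-supported-at : ∀ {k} {f : Fin k → ℤ} a → (∀ x → x ≢ a → f x ≡ + 0) → sum f ≡ f a
sum-supported-at {suc k} {f} zero f≗0 =
  trans (cong (ℤ._+_ (f zero)) (sum-zero (λ x → f≗0 (suc x) λ ()))) (ℤP.+-identityʳ (f zero))
sum-supported-at {suc k} {f} (suc a) f≗0 =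
  trans (cong₂ ℤ._+_ (f≗0 zero λ ()) (sum-supported-at a (λ x x≢a → f≗0 (suc x) (x≢a ∘ FinP.suc-injective))))
        (ℤP.+-identityˡ (f (suc a)))

sum-reindex : ∀ {k} {σ τ : Fin k → Fin k} → (∀ x → σ (τ x) ≡ x) → (∀ x → τ (σ x) ≡ x) →
              (f : Fin k → ℤ) → sum (f ∘ σ) ≡ sum f
sum-reindex στ τσ f = sym (ℤΣ.∑-permute f (permutation _ _ στ τσ))

sum-mono-≤ : ∀ {k} {f g : Fin k → ℤ} → (∀ x → f x ℤ.≤ g x) → sum f ℤ.≤ sum g
sum-mono-≤ {zero}  _   = ℤP.≤-refl
sum-mono-≤ {suc k} f≤g = ℤP.+-mono-≤ (f≤g zero) (sum-mono-≤ (f≤g ∘ suc))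

sum-nonneg : ∀ {k} {f : Fin k → ℤ} → (∀ x → + 0 ℤ.≤ f x) → + 0 ℤ.≤ sum f
sum-nonneg {k} {f} f≥0 = subst (ℤ._≤ sum f) (sum-zero {k} {λ _ → + 0} λ _ → refl) (sum-mono-≤ {k} f≥0)

three-terms≤sum : ∀ {k} {f : Fin k → ℤ} → (∀ x → + 0 ℤ.≤ f x) →
                  ∀ {a b c} → a ≢ b → a ≢ c → b ≢ c → f a ℤ.+ f b ℤ.+ f c ℤ.≤ sum f
three-terms≤sum {k} {f} f≥0 {a} {b} {c} a≢b a≢c b≢c =
  subst (ℤ._≤ sum f) sum-restriction (sum-mono-≤ {k} restriction≤f)
  where
    at : Fin k → Fin k → ℤ
    at a x = if does (x ≟ a) then f x else + 0
    sum-at : ∀ a → sum (at a) ≡ f a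
    sum-at a = trans (sum-supported-at a (λ x x≢a → if-no (x ≟ a) x≢a)) (if-yes (a ≟ a) refl)
    sum-restriction : ∑[ x < k ] (at a x ℤ.+ at b x ℤ.+ at c x) ≡ f a ℤ.+ f b ℤ.+ f c
    sum-restriction = trans (∑-distrib-+ (λ x → at a x ℤ.+ at b x) (at c))
      (cong₂ ℤ._+_ (trans (∑-distrib-+ (at a) (at b)) (cong₂ ℤ._+_ (sum-at a) (sum-at b))) (sum-at c))
    restriction≤f : ∀ x → at a x ℤ.+ at b x ℤ.+ at c x ℤ.≤ f x
    restriction≤f x with x ≟ a | x ≟ b | x ≟ c
    ... | yes refl | yes refl | _        = contradiction refl a≢b
    ... | yes refl | _        | yes refl = contradiction refl a≢c
    ... | _        | yes refl | yes refl = contradiction refl b≢c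
    ... | yes _    | no _     | no _     = ℤP.≤-reflexive (trans (ℤP.+-identityʳ _) (ℤP.+-identityʳ _))
    ... | no _     | yes _    | no _     = ℤP.≤-reflexive (trans (ℤP.+-identityʳ _) (ℤP.+-identityˡ _))
    ... | no _     | no _     | yes _    = ℤP.≤-reflexive (ℤP.+-identityˡ _)
    ... | no _     | no _     | no _     = f≥0 x

𝟙 : ∀ {p} {P : Set p} → Dec P → ℕ
𝟙 P? = if does P? then 1 else 0

sum-ones : ∀ k → ℕΣ.sum {k} (λ _ → 1) ≡ k
sum-ones zero    = refl
sum-ones (suc k) = cong suc (sum-ones k)

fixedPointFree-involution⇒2∣ : ∀ {k} {σ : Fin k → Fin k} →
                                (∀ x → σ (σ x) ≡ x) → (∀ x → σ x ≢ x) → 2 ∣ k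
fixedPointFree-involution⇒2∣ {k} {σ} σσ≗id σx≢x = divides (ℕΣ.sum before) (begin
  k                                        ≡⟨ sum-ones k ⟨
  ℕΣ.sum {k} (λ _ → 1)                     ≡⟨ ℕΣ.sum-cong-≗ exactly-one ⟨
  ℕΣ.sum (λ x → before x + before (σ x))   ≡⟨ ℕΣ.∑-distrib-+ before (before ∘ σ) ⟩
  ℕΣ.sum before + ℕΣ.sum (before ∘ σ)      ≡⟨ cong (_+_ (ℕΣ.sum before)) (ℕΣ.∑-permute before (permutation σ σ σσ≗id σσ≗id)) ⟨
  ℕΣ.sum before + ℕΣ.sum before            ≡⟨ cong (_+_ (ℕΣ.sum before)) (ℕP.+-identityʳ (ℕΣ.sum before)) ⟨
  2 * ℕΣ.sum before                        ≡⟨ ℕP.*-comm 2 (ℕΣ.sum before) ⟩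
  ℕΣ.sum before * 2                        ∎)
  where
    open ≡-Reasoning
    -- [x < σ x] selects exactly one point of each orbit {x, σ x}.
    before : Fin k → ℕ
    before x = 𝟙 (x <? σ x)
    exactly-one : ∀ x → before x + before (σ x) ≡ 1
    exactly-one x rewrite σσ≗id x with FinP.<-cmp x (σ x)
    ... | tri< x<σx _ σx≮x = cong₂ _+_ (if-yes (x <? σ x) x<σx) (if-no (σ x <? x) σx≮x)
    ... | tri≈ _ x≡σx _    = contradiction (sym x≡σx) (σx≢x x)
    ... | tri> x≮σx _ σx<x = cong₂ _+_ (if-no (x <? σ x) x≮σx) (if-yes (σ x <? x) σx<x)

2∤2k+1 : ∀ k → ¬ 2 ∣ 2 * k + 1
2∤2k+1 k 2∣2k+1 = contradiction (∣1⇒≡1 (∣m+n∣m⇒∣n 2∣2k+1 (m∣m*n k))) λ ()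

2∣[1+k]*k : ∀ k → 2 ∣ suc k * k
2∣[1+k]*k zero    = divides 0 refl
2∣[1+k]*k (suc k) = subst (2 ∣_) (expand k) (∣m∣n⇒∣m+n (2∣[1+k]*k k) (m∣m*n (suc k)))
  where
    expand : ∀ k → suc k * k + 2 * suc k ≡ suc (suc k) * suc k
    expand = solve-∀

countF≡sum : ∀ {k} {P : Fin k → Set} (P? : ∀ x → Dec (P x)) → countF P? ≡ ℕΣ.sum (λ x → 𝟙 (P? x))
countF≡sum {zero}  P? = refl
countF≡sum {suc k} P? with P? zero
... | yes _ = cong suc (countF≡sum (P? ∘ suc))
... | no _  = countF≡sum (P? ∘ suc)

maxF-upper : ∀ {k} (f : Fin k → ℕ) x → f x ≤ maxF f
maxF-upper f zero    = ℕP.m≤m⊔n (f zero) _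
maxF-upper f (suc x) = ℕP.≤-trans (maxF-upper (f ∘ suc) x) (ℕP.m≤n⊔m (f zero) _)

sumFromTo-cong : ∀ a b {F H : ℕ → ℕ} → (∀ s → F s ≡ H s) → sumFromTo a b F ≡ sumFromTo a b H
sumFromTo-cong zero    zero    F≗H = F≗H 0
sumFromTo-cong (suc a) zero    F≗H = refl
sumFromTo-cong a       (suc b) F≗H with a ≤? suc b
... | yes _ = cong₂ _+_ (sumFromTo-cong a b F≗H) (F≗H (suc b))
... | no _  = refl

module ℕ+ = CommutativeSemigroupProperties ℕP.+-commutativeSemigroup

sumFromTo-+ : ∀ a b (F H : ℕ → ℕ) →
              sumFromTo a b (λ s → F s + H s) ≡ sumFromTo a b F + sumFromTo a b H
sumFromTo-+ zero    zero    F H = refl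
sumFromTo-+ (suc a) zero    F H = refl
sumFromTo-+ a       (suc b) F H with a ≤? suc b
... | yes _ = trans (cong (_+ (F (suc b) + H (suc b))) (sumFromTo-+ a b F H))
                  (ℕ+.interchange (sumFromTo a b F) (sumFromTo a b H) (F (suc b)) (H (suc b)))
... | no _  = refl

sumFromTo-vanishing : ∀ a b {F : ℕ → ℕ} → (∀ s → s ≤ b → F s ≡ 0) → sumFromTo a b F ≡ 0
sumFromTo-vanishing zero    zero    F≗0 = F≗0 0 z≤n
sumFromTo-vanishing (suc a) zero    F≗0 = refl
sumFromTo-vanishing a       (suc b) F≗0 with a ≤? suc b
... | yes _ = cong₂ _+_ (sumFromTo-vanishing a b (λ s s≤b → F≗0 s (ℕP.m≤n⇒m≤1+n s≤b))) (F≗0 (suc b) ℕP.≤-refl)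
... | no _  = refl

sumFromTo-sum : ∀ a b {k} (F : ℕ → Fin k → ℕ) →
                sumFromTo a b (λ s → ℕΣ.sum (F s)) ≡ ℕΣ.sum (λ x → sumFromTo a b (λ s → F s x))
sumFromTo-sum a b {zero}  F = sumFromTo-vanishing a b (λ _ _ → refl)
sumFromTo-sum a b {suc k} F =
  trans (sumFromTo-+ a b (λ s → F s zero) (λ s → ℕΣ.sum (F s ∘ suc)))
        (cong (_+_ (sumFromTo a b (λ s → F s zero))) (sumFromTo-sum a b (λ s → F s ∘ suc)))

sumFromTo-supported-at : ∀ a b {v} {F : ℕ → ℕ} → v ≤ b → (∀ s → s ≢ v → F s ≡ 0) →
                         sumFromTo a b F ≡ (if does (a ≤? v) then F v else 0)
sumFromTo-supported-at zero    zero z≤n F≗0 = refl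
sumFromTo-supported-at (suc a) zero z≤n F≗0 = refl
sumFromTo-supported-at a (suc b) {v} {F} v≤1+b F≗0 with a ≤? suc b
... | no a≰1+b = sym (if-no (a ≤? v) (λ a≤v → a≰1+b (ℕP.≤-trans a≤v v≤1+b)))
... | yes a≤1+b with v ℕ.≟ suc b
...   | yes refl = trans (cong (_+ F (suc b)) (sumFromTo-vanishing a b (λ s s≤b → F≗0 s (λ { refl → ℕP.1+n≰n s≤b }))))
                         (sym (if-yes (a ≤? suc b) a≤1+b))
...   | no v≢1+b = trans (cong₂ _+_ (sumFromTo-supported-at a b (s≤s⁻¹ (ℕP.≤∧≢⇒< v≤1+b v≢1+b)) F≗0)
                                      (F≗0 (suc b) (v≢1+b ∘ sym)))
                         (ℕP.+-identityʳ _)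

square-decomposition : ∀ v → 2 * 𝟙 (1 ≤? v) + v * v
                             ≡ 3 * v + 2 * (if does (3 ≤? v) then (v ∸ 1) * (v ∸ 2) / 2 else 0)
square-decomposition 0 = refl
square-decomposition 1 = refl
square-decomposition 2 = refl
square-decomposition (suc (suc (suc k))) = begin
  2 * 1 + v * v                       ≡⟨ expand k ⟩
  3 * v + suc (suc k) * suc k         ≡⟨ cong (_+_ (3 * v)) (m*[n/m]≡n (2∣[1+k]*k (suc k))) ⟨
  3 * v + 2 * (suc (suc k) * suc k / 2) ∎
  where
    open ≡-Reasoning
    v : ℕ
    v = suc (suc (suc k))
    expand : ∀ k → 2 * 1 + (3 + k) * (3 + k) ≡ 3 * (3 + k) + (2 + k) * (1 + k)
    expand = solve-∀

module LevelSets {k} (C : Fin k → ℤ) (C≥0 : ∀ g → + 0 ℤ.≤ C g) where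

  c : Fin k → ℕ
  c g = ℤ.∣ C g ∣

  N : ℕ
  N = maxF c

  X : ℕ → ℕ
  X i = countF (λ g → C g ℤ.≟ + i)

  sumFromTo-levels : ∀ a (f : ℕ → ℕ) →
                     sumFromTo a N (λ s → f s * X s) ≡ ℕΣ.sum (λ g → if does (a ≤? c g) then f (c g) else 0)
  sumFromTo-levels a f = begin
    sumFromTo a N (λ s → f s * X s)
      ≡⟨ sumFromTo-cong a N (λ s → trans (cong (f s *_) (countF≡sum (λ g → C g ℤ.≟ + s)))
                                               (ℕΣ.*-distribˡ-sum (f s) (λ g → 𝟙 (C g ℤ.≟ + s)))) ⟩
    sumFromTo a N (λ s → ℕΣ.sum (λ g → f s * 𝟙 (C g ℤ.≟ + s)))
      ≡⟨ sumFromTo-sum a N (λ s g → f s * 𝟙 (C g ℤ.≟ + s)) ⟩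
    ℕΣ.sum (λ g → sumFromTo a N (λ s → f s * 𝟙 (C g ℤ.≟ + s)))
      ≡⟨ ℕΣ.sum-cong-≗ at-level ⟩
    ℕΣ.sum (λ g → if does (a ≤? c g) then f (c g) else 0) ∎
    where
      open ≡-Reasoning
      C≡c : ∀ g → C g ≡ + c g
      C≡c g = sym (ℤP.0≤i⇒+∣i∣≡i (C≥0 g))
      at-level : ∀ g → sumFromTo a N (λ s → f s * 𝟙 (C g ℤ.≟ + s)) ≡ (if does (a ≤? c g) then f (c g) else 0)
      at-level g = trans
        (sumFromTo-supported-at a N (maxF-upper c g)
          (λ s s≢cg → trans (cong (f s *_) (if-no (C g ℤ.≟ + s) (s≢cg ∘ sym ∘ ℤP.+-injective ∘ trans (sym (C≡c g))))) (ℕP.*-zeroʳ (f s))))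
        (cong (λ u → if does (a ≤? c g) then u else 0)
          (trans (cong (f (c g) *_) (if-yes (C g ℤ.≟ + c g) (C≡c g))) (ℕP.*-identityʳ (f (c g)))))

  level-identity : 2 * sumFromTo 1 N X + ℕΣ.sum (λ g → c g * c g)
                 ≡ 3 * ℕΣ.sum c + 2 * sumFromTo 3 N (λ s → ((s ∸ 1) * (s ∸ 2) / 2) * X s)
  level-identity = begin
    2 * sumFromTo 1 N X + ℕΣ.sum (λ g → c g * c g)
      ≡⟨ cong (λ L → 2 * L + ℕΣ.sum (λ g → c g * c g))
           (trans (sumFromTo-cong 1 N (λ s → sym (ℕP.*-identityˡ (X s)))) (sumFromTo-levels 1 (λ _ → 1))) ⟩
    2 * ℕΣ.sum (λ g → 𝟙 (1 ≤? c g)) + ℕΣ.sum (λ g → c g * c g)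
      ≡⟨ cong (_+_ (2 * ℕΣ.sum (λ g → 𝟙 (1 ≤? c g)))) (ℕP.*-identityˡ _) ⟨
    2 * ℕΣ.sum (λ g → 𝟙 (1 ≤? c g)) + 1 * ℕΣ.sum (λ g → c g * c g)
      ≡⟨ ℕΣ.sum-linear 2 1 (λ g → 𝟙 (1 ≤? c g)) (λ g → c g * c g) ⟨
    ℕΣ.sum (λ g → 2 * 𝟙 (1 ≤? c g) + 1 * (c g * c g))
      ≡⟨ ℕΣ.sum-cong-≗ (λ g → trans (cong (_+_ (2 * 𝟙 (1 ≤? c g))) (ℕP.*-identityˡ _)) (square-decomposition (c g))) ⟩
    ℕΣ.sum (λ g → 3 * c g + 2 * weight (c g))
      ≡⟨ ℕΣ.sum-linear 3 2 c (λ g → weight (c g)) ⟩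
    3 * ℕΣ.sum c + 2 * ℕΣ.sum (λ g → weight (c g))
      ≡⟨ cong (λ R → 3 * ℕΣ.sum c + 2 * R) (sumFromTo-levels 3 (λ s → (s ∸ 1) * (s ∸ 2) / 2)) ⟨
    3 * ℕΣ.sum c + 2 * sumFromTo 3 N (λ s → ((s ∸ 1) * (s ∸ 2) / 2) * X s) ∎
    where
      open ≡-Reasoning
      weight : ℕ → ℕ
      weight v = if does (3 ≤? v) then (v ∸ 1) * (v ∸ 2) / 2 else 0

*-nonneg : ∀ {i j} → + 0 ℤ.≤ i → + 0 ℤ.≤ j → + 0 ℤ.≤ i ℤ.* j
*-nonneg {+ a} {+ b} _ _ = subst (+ 0 ℤ.≤_) (ℤP.pos-* a b) (ℤ.+≤+ z≤n)

sum-pos : ∀ {k} (f : Fin k → ℕ) → ∑[ x < k ] (+ f x) ≡ + ℕΣ.sum f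
sum-pos {zero}  f = refl
sum-pos {suc k} f = cong (ℤ._+_ (+ f zero)) (sum-pos (f ∘ suc))

sum-indicator : ∀ {k} (A : Subset k) → ∑[ x < k ] (if lookup A x then + 1 else + 0) ≡ + ∣ A ∣
sum-indicator []          = refl
sum-indicator (true ∷ A)  = cong (ℤ._+_ (+ 1)) (sum-indicator A)
sum-indicator (false ∷ A) = trans (ℤP.+-identityˡ _) (sum-indicator A)

-- The group ring of a finite abelian group

module ℤ* = CommutativeSemigroupProperties ℤP.*-commutativeSemigroup

module _ {m : ℕ} (G : FinAbGroup m) where
  open FinAbGroup G
  open GroupRing G

  abelianGroup : AbelianGroup 0ℓ 0ℓ
  abelianGroup = record
    { Carrier = Fin m ; _≈_ = _≡_ ; _∙_ = _∙_ ; ε = e ; _⁻¹ = _⁻¹ ; isAbelianGroup = isAbelianGroup }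

  open AbelianGroup abelianGroup
    using (assoc; comm; identityˡ; identityʳ; inverseˡ; inverseʳ; group; commutativeSemigroup)
  open GroupProperties group
    using (\\-leftDividesˡ; \\-leftDividesʳ; ⁻¹-involutive; ⁻¹-injective; ε⁻¹≈ε; x∙y⁻¹≈ε⇒x≈y; identityˡ-unique; identityʳ-unique)
  open AbelianGroupProperties abelianGroup using (⁻¹-∙-comm)
  open CommutativeSemigroupProperties commutativeSemigroup using (interchange)

  pow-2 : ∀ h → pow h (+ 2) ≡ h ∙ h
  pow-2 h = cong (h ∙_) (identityʳ h)

  pow-1 : ∀ h → pow h -[1+ 0 ] ≡ h ⁻¹
  pow-1 h = cong _⁻¹ (identityʳ h)

  quotient≡e⇒≡ : ∀ {x y} → (y ⁻¹) ∙ x ≡ e → y ≡ x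
  quotient≡e⇒≡ {x} {y} y⁻¹x≡e = trans (sym (identityʳ y)) (trans (cong (y ∙_) (sym y⁻¹x≡e)) (\\-leftDividesˡ y x))

  quotient-square : ∀ x y → ((y ⁻¹) ∙ x) ∙ ((y ⁻¹) ∙ x) ≡ ((y ∙ y) ⁻¹) ∙ (x ∙ x)
  quotient-square x y = trans (interchange (y ⁻¹) x (y ⁻¹) x) (cong (_∙ (x ∙ x)) (⁻¹-∙-comm y y))

  ⟦⟧-0∨1 : ∀ A g → ⟦ A ⟧ g ≡ + 0 ⊎ ⟦ A ⟧ g ≡ + 1
  ⟦⟧-0∨1 A g with lookup A g
  ... | true  = inj₂ refl
  ... | false = inj₁ refl

  ⟦⟧-nonneg : ∀ A g → + 0 ℤ.≤ ⟦ A ⟧ g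
  ⟦⟧-nonneg A g with lookup A g
  ... | true  = ℤ.+≤+ z≤n
  ... | false = ℤ.+≤+ z≤n

  ⟦⟧-idem : ∀ A g → ⟦ A ⟧ g ℤ.* ⟦ A ⟧ g ≡ ⟦ A ⟧ g
  ⟦⟧-idem A g with lookup A g
  ... | true  = refl
  ... | false = refl

  ⟦⟧-∈ : ∀ {A g} → g ∈ A → ⟦ A ⟧ g ≡ + 1
  ⟦⟧-∈ g∈A rewrite []=⇒lookup g∈A = refl

  δe-e : δe e ≡ + 1
  δe-e with e ≟ e
  ... | yes _   = refl
  ... | no e≢e = contradiction refl e≢e

  δe-≢ : ∀ {g} → g ≢ e → δe g ≡ + 0
  δe-≢ {g} g≢e with g ≟ e
  ... | yes g≡e = contradiction g≡e g≢e
  ... | no _    = refl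

  ⋆-apply : ∀ A B g → (A ⋆ B) g ≡ ∑[ h < m ] (A h ℤ.* B ((h ⁻¹) ∙ g))
  ⋆-apply A B g = ΣF≡sum (λ h → A h ℤ.* B ((h ⁻¹) ∙ g))

  ⁽⁾-at-pow : ∀ A k → (∀ {x y} → pow x k ≡ pow y k → x ≡ y) → ∀ z → (A ⁽ k ⁾) (pow z k) ≡ A z
  ⁽⁾-at-pow A k pow-injective z = trans (ΣF≡sum (λ h → if does (pow h k ≟ pow z k) then A h else + 0))
    (trans (sum-supported-at z (λ h h≢z → if-no (pow h k ≟ pow z k) (h≢z ∘ pow-injective)))
           (if-yes (pow z k ≟ pow z k) refl))

  ⁽⁻¹⁾-apply : ∀ A g → (A ⁽ -[1+ 0 ] ⁾) g ≡ A (g ⁻¹)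
  ⁽⁻¹⁾-apply A g = trans (cong (A ⁽ -[1+ 0 ] ⁾) (sym (trans (pow-1 (g ⁻¹)) (⁻¹-involutive g))))
    (⁽⁾-at-pow A -[1+ 0 ] (λ p → ⁻¹-injective (trans (sym (pow-1 _)) (trans p (pow-1 _)))) (g ⁻¹))

  sum-⁽⁾-* : ∀ A k (F : ZG m) → ∑[ h < m ] ((A ⁽ k ⁾) h ℤ.* F h) ≡ ∑[ z < m ] (A z ℤ.* F (pow z k))
  sum-⁽⁾-* A k F = begin
    ∑[ h < m ] ((A ⁽ k ⁾) h ℤ.* F h)
      ≡⟨ sum-cong-≗ (λ h → trans (cong (ℤ._* F h) (ΣF≡sum (λ z → hit z h))) (*-distribʳ-sum (F h) (λ z → hit z h))) ⟩
    ∑[ h < m ] ∑[ z < m ] (hit z h ℤ.* F h)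
      ≡⟨ ∑-comm (λ h z → hit z h ℤ.* F h) ⟩
    ∑[ z < m ] ∑[ h < m ] (hit z h ℤ.* F h)
      ≡⟨ sum-cong-≗ (λ z → sum-supported-at (pow z k) (λ h h≢zᵏ →
           trans (cong (ℤ._* F h) (if-no (pow z k ≟ h) (h≢zᵏ ∘ sym))) (ℤP.*-zeroˡ (F h)))) ⟩
    ∑[ z < m ] (hit z (pow z k) ℤ.* F (pow z k))
      ≡⟨ sum-cong-≗ (λ z → cong (ℤ._* F (pow z k)) (if-yes (pow z k ≟ pow z k) refl)) ⟩
    ∑[ z < m ] (A z ℤ.* F (pow z k)) ∎
    where
      open ≡-Reasoning
      hit : Fin m → Fin m → ℤ
      hit z h = if does (pow z k ≟ h) then A z else + 0

  sum-⁽²⁾-* : ∀ A (F : ZG m) → ∑[ h < m ] ((A ⁽ + 2 ⁾) h ℤ.* F h) ≡ ∑[ z < m ] (A z ℤ.* F (z ∙ z))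
  sum-⁽²⁾-* A F = trans (sum-⁽⁾-* A (+ 2) F) (sum-cong-≗ (λ z → cong (λ w → A z ℤ.* F w) (pow-2 z)))

  sum-⁽⁾ : ∀ A k → sum (A ⁽ k ⁾) ≡ sum A
  sum-⁽⁾ A k = begin
    sum (A ⁽ k ⁾)                          ≡⟨ sum-cong-≗ (λ h → ℤP.*-identityʳ ((A ⁽ k ⁾) h)) ⟨
    ∑[ h < m ] ((A ⁽ k ⁾) h ℤ.* + 1)      ≡⟨ sum-⁽⁾-* A k (λ _ → + 1) ⟩
    ∑[ z < m ] (A z ℤ.* + 1)               ≡⟨ sum-cong-≗ (λ z → ℤP.*-identityʳ (A z)) ⟩
    sum A                                  ∎
    where open ≡-Reasoning

  sum-⋆ : ∀ A B → sum (A ⋆ B) ≡ sum A ℤ.* sum B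
  sum-⋆ A B = begin
    sum (A ⋆ B)                                        ≡⟨ sum-cong-≗ (⋆-apply A B) ⟩
    ∑[ g < m ] ∑[ h < m ] (A h ℤ.* B ((h ⁻¹) ∙ g))    ≡⟨ ∑-comm (λ g h → A h ℤ.* B ((h ⁻¹) ∙ g)) ⟩
    ∑[ h < m ] ∑[ g < m ] (A h ℤ.* B ((h ⁻¹) ∙ g))    ≡⟨ sum-cong-≗ (λ h → *-distribˡ-sum (A h) (λ g → B ((h ⁻¹) ∙ g))) ⟨
    ∑[ h < m ] (A h ℤ.* ∑[ g < m ] B ((h ⁻¹) ∙ g))    ≡⟨ sum-cong-≗ (λ h → cong (A h ℤ.*_)
                                                            (sum-reindex (\\-leftDividesʳ h) (\\-leftDividesˡ h) B)) ⟩
    ∑[ h < m ] (A h ℤ.* sum B)                         ≡⟨ *-distribʳ-sum (sum B) A ⟨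
    sum A ℤ.* sum B                                    ∎
    where open ≡-Reasoning

  ⋆-nonneg : ∀ {A B} → (∀ g → + 0 ℤ.≤ A g) → (∀ g → + 0 ℤ.≤ B g) → ∀ g → + 0 ℤ.≤ (A ⋆ B) g
  ⋆-nonneg {A} {B} A≥0 B≥0 g =
    subst (+ 0 ℤ.≤_) (sym (⋆-apply A B g)) (sum-nonneg (λ h → *-nonneg (A≥0 h) (B≥0 _)))

  ⁽⁾-nonneg : ∀ {A} → (∀ g → + 0 ℤ.≤ A g) → ∀ k g → + 0 ℤ.≤ (A ⁽ k ⁾) g
  ⁽⁾-nonneg {A} A≥0 k g = subst (+ 0 ℤ.≤_) (sym (ΣF≡sum (λ h → if does (pow h k ≟ g) then A h else + 0)))
                                (sum-nonneg (λ h → if-nonneg (does (pow h k ≟ g)) (A≥0 h)))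
    where
      if-nonneg : ∀ b {x} → + 0 ℤ.≤ x → + 0 ℤ.≤ (if b then x else + 0)
      if-nonneg true  x≥0 = x≥0
      if-nonneg false _   = ℤP.≤-refl

  sum-δe : sum δe ≡ + 1
  sum-δe = trans (sum-supported-at e (λ _ → δe-≢)) δe-e

  sum-*δe : ∀ (A : ZG m) → ∑[ x < m ] (A x ℤ.* δe x) ≡ A e
  sum-*δe A = trans (sum-supported-at e (λ x x≢e → trans (cong (A x ℤ.*_) (δe-≢ x≢e)) (ℤP.*-zeroʳ (A x))))
                    (trans (cong (A e ℤ.*_) δe-e) (ℤP.*-identityʳ (A e)))

  sum-translates-* : ∀ A B a b → (∀ g → A (g ⁻¹) ≡ A g) →
                     ∑[ g < m ] (A ((a ⁻¹) ∙ g) ℤ.* B ((b ⁻¹) ∙ g)) ≡ (A ⋆ B) ((b ⁻¹) ∙ a)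
  sum-translates-* A B a b A-sym = begin
    ∑[ g < m ] (A ((a ⁻¹) ∙ g) ℤ.* B ((b ⁻¹) ∙ g))
      ≡⟨ sum-reindex {σ = λ h → a ∙ (h ⁻¹)} στ τσ (λ g → A ((a ⁻¹) ∙ g) ℤ.* B ((b ⁻¹) ∙ g)) ⟨
    ∑[ h < m ] (A ((a ⁻¹) ∙ (a ∙ (h ⁻¹))) ℤ.* B ((b ⁻¹) ∙ (a ∙ (h ⁻¹))))
      ≡⟨ sum-cong-≗ (λ h → cong₂ ℤ._*_ (trans (cong A (\\-leftDividesʳ a (h ⁻¹))) (A-sym h)) (cong B (regroup h))) ⟩
    ∑[ h < m ] (A h ℤ.* B ((h ⁻¹) ∙ ((b ⁻¹) ∙ a)))
      ≡⟨ ⋆-apply A B ((b ⁻¹) ∙ a) ⟨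
    (A ⋆ B) ((b ⁻¹) ∙ a) ∎
    where
      open ≡-Reasoning
      στ : ∀ g → a ∙ ((((a ⁻¹) ∙ g) ⁻¹) ⁻¹) ≡ g
      στ g = trans (cong (a ∙_) (⁻¹-involutive _)) (\\-leftDividesˡ a g)
      τσ : ∀ h → ((a ⁻¹) ∙ (a ∙ (h ⁻¹))) ⁻¹ ≡ h
      τσ h = trans (cong _⁻¹ (\\-leftDividesʳ a (h ⁻¹))) (⁻¹-involutive h)
      regroup : ∀ h → (b ⁻¹) ∙ (a ∙ (h ⁻¹)) ≡ (h ⁻¹) ∙ ((b ⁻¹) ∙ a)
      regroup h = trans (sym (assoc (b ⁻¹) a (h ⁻¹))) (comm ((b ⁻¹) ∙ a) (h ⁻¹))

  ⁽²⁾⋆-apply : ∀ B A g → ((B ⁽ + 2 ⁾) ⋆ A) g ≡ ∑[ x < m ] (B x ℤ.* A (((x ∙ x) ⁻¹) ∙ g))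
  ⁽²⁾⋆-apply B A g = trans (⋆-apply (B ⁽ + 2 ⁾) A g) (sum-⁽²⁾-* B (λ h → A ((h ⁻¹) ∙ g)))

  sum-square-⁽²⁾⋆ : ∀ B A → (∀ g → A (g ⁻¹) ≡ A g) →
                    ∑[ g < m ] (((B ⁽ + 2 ⁾) ⋆ A) g ℤ.* ((B ⁽ + 2 ⁾) ⋆ A) g)
                    ≡ ∑[ x < m ] ∑[ y < m ] (B x ℤ.* B y ℤ.* (A ⋆ A) (((y ∙ y) ⁻¹) ∙ (x ∙ x)))
  sum-square-⁽²⁾⋆ B A A-sym = begin
    ∑[ g < m ] (((B ⁽ + 2 ⁾) ⋆ A) g ℤ.* ((B ⁽ + 2 ⁾) ⋆ A) g)
      ≡⟨ sum-cong-≗ (λ g → trans (cong₂ ℤ._*_ (⁽²⁾⋆-apply B A g) (⁽²⁾⋆-apply B A g)) (ℤΣ.sum-*-sum (term g) (term g))) ⟩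
    ∑[ g < m ] ∑[ x < m ] ∑[ y < m ] (term g x ℤ.* term g y)
      ≡⟨ ∑-comm (λ g x → ∑[ y < m ] (term g x ℤ.* term g y)) ⟩
    ∑[ x < m ] ∑[ g < m ] ∑[ y < m ] (term g x ℤ.* term g y)
      ≡⟨ sum-cong-≗ (λ x → ∑-comm (λ g y → term g x ℤ.* term g y)) ⟩
    ∑[ x < m ] ∑[ y < m ] ∑[ g < m ] (term g x ℤ.* term g y)
      ≡⟨ sum-cong-≗ (λ x → sum-cong-≗ (λ y → correlate x y)) ⟩
    ∑[ x < m ] ∑[ y < m ] (B x ℤ.* B y ℤ.* (A ⋆ A) (((y ∙ y) ⁻¹) ∙ (x ∙ x))) ∎
    where
      open ≡-Reasoning
      term : Fin m → Fin m → ℤ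
      term g x = B x ℤ.* A (((x ∙ x) ⁻¹) ∙ g)
      correlate : ∀ x y → ∑[ g < m ] (term g x ℤ.* term g y) ≡ B x ℤ.* B y ℤ.* (A ⋆ A) (((y ∙ y) ⁻¹) ∙ (x ∙ x))
      correlate x y = begin
        ∑[ g < m ] (term g x ℤ.* term g y)
          ≡⟨ sum-cong-≗ (λ g → ℤ*.interchange (B x) (A (((x ∙ x) ⁻¹) ∙ g)) (B y) (A (((y ∙ y) ⁻¹) ∙ g))) ⟩
        ∑[ g < m ] (B x ℤ.* B y ℤ.* (A (((x ∙ x) ⁻¹) ∙ g) ℤ.* A (((y ∙ y) ⁻¹) ∙ g)))
          ≡⟨ *-distribˡ-sum (B x ℤ.* B y) (λ g → A (((x ∙ x) ⁻¹) ∙ g) ℤ.* A (((y ∙ y) ⁻¹) ∙ g)) ⟨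
        B x ℤ.* B y ℤ.* ∑[ g < m ] (A (((x ∙ x) ⁻¹) ∙ g) ℤ.* A (((y ∙ y) ⁻¹) ∙ g))
          ≡⟨ cong (B x ℤ.* B y ℤ.*_) (sum-translates-* A A (x ∙ x) (y ∙ y) A-sym) ⟩
        B x ℤ.* B y ℤ.* (A ⋆ A) (((y ∙ y) ⁻¹) ∙ (x ∙ x)) ∎

  -- Groups of odd order

  module _ (m-odd : ¬ 2 ∣ m) where

    square≡e⇒≡e : ∀ {w} → w ∙ w ≡ e → w ≡ e
    square≡e⇒≡e {w} w²≡e with w ≟ e
    ... | yes w≡e = w≡e
    ... | no w≢e  = contradiction (fixedPointFree-involution⇒2∣ {σ = w ∙_} ww≗id w·-fixedPointFree) m-odd
      where
        ww≗id : ∀ x → w ∙ (w ∙ x) ≡ x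
        ww≗id x = trans (sym (assoc w w x)) (trans (cong (_∙ x) w²≡e) (identityˡ x))
        w·-fixedPointFree : ∀ x → w ∙ x ≢ x
        w·-fixedPointFree x wx≡x = w≢e (identityˡ-unique w x wx≡x)

    square-injective : ∀ {x y} → x ∙ x ≡ y ∙ y → x ≡ y
    square-injective {x} {y} x²≡y² = x∙y⁻¹≈ε⇒x≈y x y (square≡e⇒≡e (begin
      (x ∙ (y ⁻¹)) ∙ (x ∙ (y ⁻¹)) ≡⟨ interchange x (y ⁻¹) x (y ⁻¹) ⟩
      (x ∙ x) ∙ ((y ⁻¹) ∙ (y ⁻¹)) ≡⟨ cong₂ _∙_ x²≡y² (⁻¹-∙-comm y y) ⟩
      (y ∙ y) ∙ ((y ∙ y) ⁻¹)      ≡⟨ inverseʳ (y ∙ y) ⟩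
      e                           ∎))
      where open ≡-Reasoning

    ⁽²⁾-at-square : ∀ A z → (A ⁽ + 2 ⁾) (z ∙ z) ≡ A z
    ⁽²⁾-at-square A z = trans (cong (A ⁽ + 2 ⁾) (sym (pow-2 z)))
      (⁽⁾-at-pow A (+ 2) (λ p → square-injective (trans (sym (pow-2 _)) (trans p (pow-2 _)))) z)

    sum-δe-quotient : ∀ (f : ZG m) x → ∑[ y < m ] (f y ℤ.* δe (((y ∙ y) ⁻¹) ∙ (x ∙ x))) ≡ f x
    sum-δe-quotient f x = trans (sum-supported-at x off-diagonal)
      (trans (cong (f x ℤ.*_) (trans (cong δe (inverseˡ (x ∙ x))) δe-e)) (ℤP.*-identityʳ (f x)))
      where
        off-diagonal : ∀ y → y ≢ x → f y ℤ.* δe (((y ∙ y) ⁻¹) ∙ (x ∙ x)) ≡ + 0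
        off-diagonal y y≢x = trans
          (cong (f y ℤ.*_) (δe-≢ (y≢x ∘ quotient≡e⇒≡ ∘ square≡e⇒≡e ∘ trans (quotient-square x y))))
          (ℤP.*-zeroʳ (f y))

  module SquareEquation
    (T : Subset m) (n : ℕ) (m≡ : m ≡ 2 * (n * n) + 2 * n + 1) (|T|≡ : ∣ T ∣ ≡ 2 * n + 1) (e∈T : e ∈ T)
    (T-sym : ∀ g → ⟦ T ⟧ g ≡ (⟦ T ⟧ ⁽ -[1+ 0 ] ⁾) g)
    (T²≡ : ∀ g → (⟦ T ⟧ ⋆ ⟦ T ⟧) g ≡ (+ 2 ℤ.* 𝔾 g ℤ.- (⟦ T ⟧ ⁽ + 2 ⁾) g) ℤ.+ (+ (2 * n)) ℤ.* δe g)
    where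

    t : ZG m
    t = ⟦ T ⟧

    C : ZG m
    C = (t ⁽ + 2 ⁾) ⋆ t

    m-odd : ¬ 2 ∣ m
    m-odd = subst (λ k → ¬ 2 ∣ k) (sym (trans m≡ (cong (ℕ._+ 1) (sym (ℕP.*-distribˡ-+ 2 (n * n) n)))))
                  (2∤2k+1 (n * n + n))

    t-inv : ∀ g → t (g ⁻¹) ≡ t g
    t-inv g = sym (trans (T-sym g) (⁽⁻¹⁾-apply t g))

    t-e : t e ≡ + 1
    t-e = ⟦⟧-∈ e∈T

    sum-t : sum t ≡ + (2 * n + 1)
    sum-t = trans (sum-indicator T) (cong +_ |T|≡)

    T²+T⁽²⁾ : ∀ g → (t ⋆ t) g ℤ.+ (t ⁽ + 2 ⁾) g ≡ + 2 ℤ.+ + (2 * n) ℤ.* δe g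
    T²+T⁽²⁾ g = trans (cong (ℤ._+ (t ⁽ + 2 ⁾) g) (T²≡ g)) (rearrange ((t ⁽ + 2 ⁾) g) (+ (2 * n) ℤ.* δe g))
      where
        rearrange : ∀ s d → (+ 2 ℤ.* + 1 ℤ.- s) ℤ.+ d ℤ.+ s ≡ + 2 ℤ.+ d
        rearrange = ℤ-Solver.solve-∀

    t-square-free : ∀ {x} → x ≢ e → t x ≡ + 1 → t (x ∙ x) ≡ + 1 → ⊥
    t-square-free {x} x≢e tx≡1 tx²≡1 = 3≰2 (ℤP.≤-trans three≤T² T²≤two)
      where
        3≰2 : ¬ (+ 3 ℤ.≤ + 2)
        3≰2 (ℤ.+≤+ (s≤s (s≤s ())))
        pair-e : t e ℤ.* t ((e ⁻¹) ∙ x) ≡ + 1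
        pair-e = cong₂ ℤ._*_ t-e (trans (cong t (trans (cong (_∙ x) ε⁻¹≈ε) (identityˡ x))) tx≡1)
        pair-x : t x ℤ.* t ((x ⁻¹) ∙ x) ≡ + 1
        pair-x = cong₂ ℤ._*_ tx≡1 (trans (cong t (inverseˡ x)) t-e)
        pair-x² : t (x ∙ x) ℤ.* t (((x ∙ x) ⁻¹) ∙ x) ≡ + 1
        pair-x² = cong₂ ℤ._*_ tx²≡1 (trans (cong t x⁻²x≡x⁻¹) (trans (t-inv x) tx≡1))
          where
            x⁻²x≡x⁻¹ : ((x ∙ x) ⁻¹) ∙ x ≡ x ⁻¹
            x⁻²x≡x⁻¹ = trans (cong (_∙ x) (sym (⁻¹-∙-comm x x)))
                        (trans (assoc (x ⁻¹) (x ⁻¹) x) (trans (cong ((x ⁻¹) ∙_) (inverseˡ x)) (identityʳ (x ⁻¹))))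
        three≤T² : + 3 ℤ.≤ (t ⋆ t) x
        three≤T² = subst₂ ℤ._≤_ (cong₂ ℤ._+_ (cong₂ ℤ._+_ pair-e pair-x) pair-x²) (sym (⋆-apply t t x))
          (three-terms≤sum (λ h → *-nonneg (⟦⟧-nonneg T h) (⟦⟧-nonneg T _))
            (x≢e ∘ sym) (x≢e ∘ square≡e⇒≡e m-odd ∘ sym) (x≢e ∘ identityʳ-unique x x ∘ sym))
        T²≤two : (t ⋆ t) x ℤ.≤ + 2
        T²≤two = subst₂ ℤ._≤_ (ℤP.+-identityʳ ((t ⋆ t) x))
          (trans (T²+T⁽²⁾ x) (trans (cong (λ d → + 2 ℤ.+ + (2 * n) ℤ.* d) (δe-≢ x≢e))
                                    (cong (ℤ._+_ (+ 2)) (ℤP.*-zeroʳ (+ (2 * n))))))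
          (ℤP.+-monoʳ-≤ ((t ⋆ t) x) (⁽⁾-nonneg (⟦⟧-nonneg T) (+ 2) x))

    t·t-square≡δe : ∀ z → t z ℤ.* t (z ∙ z) ≡ δe z
    t·t-square≡δe z with z ≟ e | ⟦⟧-0∨1 T z | ⟦⟧-0∨1 T (z ∙ z)
    ... | yes refl | _         | _          = cong₂ ℤ._*_ t-e (trans (cong t (identityˡ e)) t-e)
    ... | no _     | inj₁ tz≡0 | _          = cong (ℤ._* t (z ∙ z)) tz≡0
    ... | no _     | inj₂ _    | inj₁ tz²≡0 = trans (cong (t z ℤ.*_) tz²≡0) (ℤP.*-zeroʳ (t z))
    ... | no z≢e   | inj₂ tz≡1 | inj₂ tz²≡1 = contradiction tz²≡1 (t-square-free z≢e tz≡1)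

    sum-t⁽²⁾·t : ∑[ x < m ] ((t ⁽ + 2 ⁾) x ℤ.* t x) ≡ + 1
    sum-t⁽²⁾·t = trans (sum-⁽²⁾-* t t) (trans (sum-cong-≗ t·t-square≡δe) sum-δe)

    spread : ∀ a N d → a ℤ.* (+ 2 ℤ.+ N ℤ.* d) ≡ + 2 ℤ.* a ℤ.+ N ℤ.* (a ℤ.* d)
    spread = ℤ-Solver.solve-∀

    Q : ℤ
    Q = ∑[ x < m ] (t x ℤ.* (t ⋆ t) x)

    Q+1 : Q ℤ.+ + 1 ≡ + 2 ℤ.* sum t ℤ.+ + (2 * n)
    Q+1 = begin
      Q ℤ.+ + 1
        ≡⟨ cong (ℤ._+_ Q) (trans (sym sum-t⁽²⁾·t) (sum-cong-≗ (λ x → ℤP.*-comm ((t ⁽ + 2 ⁾) x) (t x)))) ⟩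
      Q ℤ.+ ∑[ x < m ] (t x ℤ.* (t ⁽ + 2 ⁾) x)
        ≡⟨ ∑-distrib-+ (λ x → t x ℤ.* (t ⋆ t) x) (λ x → t x ℤ.* (t ⁽ + 2 ⁾) x) ⟨
      ∑[ x < m ] (t x ℤ.* (t ⋆ t) x ℤ.+ t x ℤ.* (t ⁽ + 2 ⁾) x)
        ≡⟨ sum-cong-≗ (λ x → trans (sym (ℤP.*-distribˡ-+ (t x) ((t ⋆ t) x) ((t ⁽ + 2 ⁾) x)))
                                   (trans (cong (t x ℤ.*_) (T²+T⁽²⁾ x)) (spread (t x) (+ (2 * n)) (δe x)))) ⟩
      ∑[ x < m ] (+ 2 ℤ.* t x ℤ.+ + (2 * n) ℤ.* (t x ℤ.* δe x))
        ≡⟨ ℤΣ.sum-linear (+ 2) (+ (2 * n)) t (λ x → t x ℤ.* δe x) ⟩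
      + 2 ℤ.* sum t ℤ.+ + (2 * n) ℤ.* ∑[ x < m ] (t x ℤ.* δe x)
        ≡⟨ cong (λ s → + 2 ℤ.* sum t ℤ.+ + (2 * n) ℤ.* s) (trans (sum-*δe t) t-e) ⟩
      + 2 ℤ.* sum t ℤ.+ + (2 * n) ℤ.* + 1
        ≡⟨ cong (ℤ._+_ (+ 2 ℤ.* sum t)) (ℤP.*-identityʳ (+ (2 * n))) ⟩
      + 2 ℤ.* sum t ℤ.+ + (2 * n) ∎
      where open ≡-Reasoning

    Q-as-double-sum : Q ≡ ∑[ x < m ] ∑[ y < m ] (t x ℤ.* t y ℤ.* (t ⁽ + 2 ⁾) (((y ∙ y) ⁻¹) ∙ (x ∙ x)))
    Q-as-double-sum = sum-cong-≗ λ x → trans (cong (t x ℤ.*_) (⋆-apply t t x))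
      (trans (*-distribˡ-sum (t x) (λ y → t y ℤ.* t ((y ⁻¹) ∙ x)))
             (sum-cong-≗ λ y → trans (sym (ℤP.*-assoc (t x) (t y) _))
               (cong (t x ℤ.* t y ℤ.*_) (sym (trans (cong (t ⁽ + 2 ⁾) (sym (quotient-square x y)))
                                                    (⁽²⁾-at-square m-odd t ((y ⁻¹) ∙ x)))))))

    sum-C²+Q : ∑[ g < m ] (C g ℤ.* C g) ℤ.+ Q ≡ + 2 ℤ.* (sum t ℤ.* sum t) ℤ.+ + (2 * n) ℤ.* sum t
    sum-C²+Q = begin
      ∑[ g < m ] (C g ℤ.* C g) ℤ.+ Q
        ≡⟨ cong₂ ℤ._+_ (sum-square-⁽²⁾⋆ t t t-inv) Q-as-double-sum ⟩
      ∑[ x < m ] ∑[ y < m ] (t x ℤ.* t y ℤ.* (t ⋆ t) (w x y))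
        ℤ.+ ∑[ x < m ] ∑[ y < m ] (t x ℤ.* t y ℤ.* (t ⁽ + 2 ⁾) (w x y))
        ≡⟨ ℤΣ.∑∑-distrib-+ (λ x y → t x ℤ.* t y ℤ.* (t ⋆ t) (w x y)) (λ x y → t x ℤ.* t y ℤ.* (t ⁽ + 2 ⁾) (w x y)) ⟨
      ∑[ x < m ] ∑[ y < m ] (t x ℤ.* t y ℤ.* (t ⋆ t) (w x y) ℤ.+ t x ℤ.* t y ℤ.* (t ⁽ + 2 ⁾) (w x y))
        ≡⟨ sum-cong-≗ (λ x → sum-cong-≗ λ y →
             trans (sym (ℤP.*-distribˡ-+ (t x ℤ.* t y) ((t ⋆ t) (w x y)) ((t ⁽ + 2 ⁾) (w x y))))
                   (trans (cong (t x ℤ.* t y ℤ.*_) (T²+T⁽²⁾ (w x y))) (spread (t x ℤ.* t y) (+ (2 * n)) (δe (w x y))))) ⟩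
      ∑[ x < m ] ∑[ y < m ] (+ 2 ℤ.* (t x ℤ.* t y) ℤ.+ + (2 * n) ℤ.* (t x ℤ.* t y ℤ.* δe (w x y)))
        ≡⟨ ℤΣ.∑∑-linear (+ 2) (+ (2 * n)) (λ x y → t x ℤ.* t y) (λ x y → t x ℤ.* t y ℤ.* δe (w x y)) ⟩
      + 2 ℤ.* ∑[ x < m ] ∑[ y < m ] (t x ℤ.* t y) ℤ.+ + (2 * n) ℤ.* ∑[ x < m ] ∑[ y < m ] (t x ℤ.* t y ℤ.* δe (w x y))
        ≡⟨ cong₂ (λ u v → + 2 ℤ.* u ℤ.+ + (2 * n) ℤ.* v)
             (sym (ℤΣ.sum-*-sum t t))
             (trans (sum-cong-≗ λ x → sum-δe-quotient m-odd (λ y → t x ℤ.* t y) x) (sum-cong-≗ (⟦⟧-idem T))) ⟩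
      + 2 ℤ.* (sum t ℤ.* sum t) ℤ.+ + (2 * n) ℤ.* sum t ∎
      where
        open ≡-Reasoning
        w : Fin m → Fin m → Fin m
        w x y = ((y ∙ y) ⁻¹) ∙ (x ∙ x)

    C-nonneg : ∀ g → + 0 ℤ.≤ C g
    C-nonneg = ⋆-nonneg (⁽⁾-nonneg (⟦⟧-nonneg T) (+ 2)) (⟦⟧-nonneg T)

    c : Fin m → ℕ
    c g = ℤ.∣ C g ∣

    c≡C : ∀ g → + c g ≡ C g
    c≡C g = ℤP.0≤i⇒+∣i∣≡i (C-nonneg g)

    sum-c : ℕΣ.sum c ≡ (2 * n + 1) * (2 * n + 1)
    sum-c = ℤP.+-injective (begin
      + ℕΣ.sum c                         ≡⟨ sum-pos c ⟨
      ∑[ g < m ] (+ c g)                 ≡⟨ sum-cong-≗ c≡C ⟩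
      sum C                              ≡⟨ sum-⋆ (t ⁽ + 2 ⁾) t ⟩
      sum (t ⁽ + 2 ⁾) ℤ.* sum t          ≡⟨ cong (ℤ._* sum t) (sum-⁽⁾ t (+ 2)) ⟩
      sum t ℤ.* sum t                    ≡⟨ cong₂ ℤ._*_ sum-t sum-t ⟩
      + (2 * n + 1) ℤ.* + (2 * n + 1)    ≡⟨ ℤP.pos-* (2 * n + 1) (2 * n + 1) ⟨
      + ((2 * n + 1) * (2 * n + 1))      ∎)
      where open ≡-Reasoning

    sum-c² : ℕΣ.sum (λ g → c g * c g) ≡ 12 * (n * n) + 4 * n + 1
    sum-c² = ℕP.+-cancelʳ-≡ (2 * s + 2 * n) _ _ (trans (ℤP.+-injective moments) (arith n))
      where
        open ≡-Reasoning
        s : ℕ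
        s = 2 * n + 1
        P : ℤ
        P = ∑[ g < m ] (C g ℤ.* C g)
        moments : + (ℕΣ.sum (λ g → c g * c g) + (2 * s + 2 * n)) ≡ + (2 * (s * s) + 2 * n * s + 1)
        moments = begin
          + ℕΣ.sum (λ g → c g * c g) ℤ.+ (+ (2 * s) ℤ.+ + (2 * n))
            ≡⟨ cong₂ (λ u v → u ℤ.+ (v ℤ.+ + (2 * n)))
                 (trans (sym (sum-pos (λ g → c g * c g)))
                        (sum-cong-≗ λ g → trans (ℤP.pos-* (c g) (c g)) (cong₂ ℤ._*_ (c≡C g) (c≡C g))))
                 (trans (ℤP.pos-* 2 s) (cong (ℤ._*_ (+ 2)) (sym sum-t))) ⟩
          P ℤ.+ (+ 2 ℤ.* sum t ℤ.+ + (2 * n))  ≡⟨ cong (ℤ._+_ P) Q+1 ⟨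
          P ℤ.+ (Q ℤ.+ + 1)                     ≡⟨ ℤP.+-assoc P Q (+ 1) ⟨
          P ℤ.+ Q ℤ.+ + 1                       ≡⟨ cong (ℤ._+ + 1) sum-C²+Q ⟩
          + 2 ℤ.* (sum t ℤ.* sum t) ℤ.+ + (2 * n) ℤ.* sum t ℤ.+ + 1
            ≡⟨ cong (λ S → + 2 ℤ.* (S ℤ.* S) ℤ.+ + (2 * n) ℤ.* S ℤ.+ + 1) sum-t ⟩
          + 2 ℤ.* (+ s ℤ.* + s) ℤ.+ + (2 * n) ℤ.* + s ℤ.+ + 1
            ≡⟨ cong₂ (λ u v → u ℤ.+ v ℤ.+ + 1)
                 (trans (cong (ℤ._*_ (+ 2)) (sym (ℤP.pos-* s s))) (sym (ℤP.pos-* 2 (s * s))))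
                 (sym (ℤP.pos-* (2 * n) s)) ⟩
          + (2 * (s * s) + 2 * n * s + 1) ∎
        arith : ∀ n → 2 * ((2 * n + 1) * (2 * n + 1)) + 2 * n * (2 * n + 1) + 1
                      ≡ 12 * (n * n) + 4 * n + 1 + (2 * (2 * n + 1) + 2 * n)
        arith = solve-∀

-- The identity holds for every n.
lemma3p2 : (n : ℕ) → n ≥ 2 → (m : ℕ) → m ≡ 2 * (n * n) + 2 * n + 1 →
  (G : FinAbGroup m) → (T : Subset m) → ∣ T ∣ ≡ 2 * n + 1 →
  let open FinAbGroup G
      open GroupRing G
      C : ZG m
      C = (⟦ T ⟧ ⁽ + 2 ⁾) ⋆ ⟦ T ⟧
      X : ℕ → ℕ
      X i = countF (λ g → C g ℤ.≟ + i)
      N : ℕ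
      N = maxF (λ g → ℤ.∣ C g ∣)
  in e ∈ T →
     (∀ g → ⟦ T ⟧ g ≡ (⟦ T ⟧ ⁽ -[1+ 0 ] ⁾) g) →
     (∀ g → (⟦ T ⟧ ⋆ ⟦ T ⟧) g
              ≡ (+ 2 ℤ.* 𝔾 g ℤ.- (⟦ T ⟧ ⁽ + 2 ⁾) g) ℤ.+ (+ (2 * n)) ℤ.* δe g) →
     sumFromTo 1 N X
       ≡ 4 * n + 1 + sumFromTo 3 N (λ s → ((s ∸ 1) * (s ∸ 2) / 2) * X s)
lemma3p2 n _ m m≡ G T |T|≡ e∈T T-sym T²≡ =
  ℕP.*-cancelˡ-≡ _ _ 2 (ℕP.+-cancelʳ-≡ (12 * (n * n) + 4 * n + 1) _ _ (begin
    2 * L + (12 * (n * n) + 4 * n + 1)    ≡⟨ cong (_+_ (2 * L)) sum-c² ⟨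
    2 * L + ℕΣ.sum (λ g → c g * c g)      ≡⟨ level-identity ⟩
    3 * ℕΣ.sum c + 2 * R                  ≡⟨ cong (λ u → 3 * u + 2 * R) sum-c ⟩
    3 * ((2 * n + 1) * (2 * n + 1)) + 2 * R ≡⟨ arith n R ⟩
    2 * (4 * n + 1 + R) + (12 * (n * n) + 4 * n + 1) ∎))
  where
    open SquareEquation G T n m≡ |T|≡ e∈T T-sym T²≡
    open LevelSets C C-nonneg using (N; X; level-identity)
    open ≡-Reasoning
    L R : ℕ
    L = sumFromTo 1 N X
    R = sumFromTo 3 N (λ s → ((s ∸ 1) * (s ∸ 2) / 2) * X s)
    arith : ∀ n R → 3 * ((2 * n + 1) * (2 * n + 1)) + 2 * R ≡ 2 * (4 * n + 1 + R) + (12 * (n * n) + 4 * n + 1)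
    arith = solve-∀
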